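{- Let $\mathcal{F}=(V,\theta,O)$ be a knowledge structure, $s$ a state of $\mathcal{F}$, $L=[\ell_0,\ldots,\ell_k]$ a list of $\mathcal{L}_{\mathsf{PAL}}(V)$-formulas and $\phi\in\mathcal{L}_{\mathsf{PAL}}(V)$. Then $\mathcal{F}^{\ell_0\ldots\ell_k},s\vDash\phi$ if and only if $\mathsf{check}(\mathcal{F},L,s,\phi)$ returns $\mathsf{true}$.
   Context: Vocabulary $V$: finite set of atoms; $A$: finite set of agents. Boolean formulas over $V$: $\beta::=\top\mid\bot\mid p\mid\neg\beta\mid\beta\land\beta$; states are subsets $s\subseteq V$, $s\vDash\beta$ ordinary satisfaction. $\forall p\,\beta:=[p\mapsto\top]\beta\land[p\mapsto\bot]\beta$, extended to finite sets of atoms. $\mathcal{L}_{\mathsf{PAL}}(V)$: $\phi::=\top\mid\bot\mid p\mid\neg\phi\mid\phi\land\phi\mid K_i\phi\mid[!\psi]\phi$ ($p\in V$, $i\in A$). A knowledge structure is $\mathcal{F}=(V,\theta,O)$ with $\theta$ Boolean over $V$ and $O_i\subseteq V$ for $i\in A$; its states are $s\subseteq V$ with $s\vDash\theta$. Semantics: $\mathcal{F},s\vDash\top$; not $\bot$; $p$ iff $p\in s$; $\neg,\land$ as usual; $\mathcal{F},s\vDash K_i\phi$ iff for all states $t$ of $\mathcal{F}$ with $s\cap O_i=t\cap O_i$, $\mathcal{F},t\vDash\phi$; $\mathcal{F},s\vDash[!\psi]\phi$ iff $\mathcal{F},s\vDash\psi$ implies $\mathcal{F}^\psi,s\vDash\phi$,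 where $\mathcal{F}^\psi:=(V,\theta\land\|\psi\|_{\mathcal{F}},O)$ and the Boolean translation is: $\|\cdot\|_{\mathcal{F}}$ is the identity on $\top,\bot,p$, commutes with $\neg,\land$, $\|K_i\psi\|_{\mathcal{F}}=\forall(V\setminus O_i)(\theta\to\|\psi\|_{\mathcal{F}})$, $\|[!\psi]\xi\|_{\mathcal{F}}=\|\psi\|_{\mathcal{F}}\to\|\xi\|_{\mathcal{F}^\psi}$. Iterated announcement: $\mathcal{F}^{\ell_0\ldots\ell_k}:=(\cdots((\mathcal{F}^{\ell_0})^{\ell_1})\cdots)^{\ell_k}$ (for $k=-1$, i.e. $L=[]$, this is $\mathcal{F}$). The procedure $\mathsf{check}(\mathcal{F},L,s,\phi)$, with $L=[\ell_0,\ldots,\ell_k]$, is defined recursively on $\phi$: for $\top$ return true; for $\bot$ return false; for $p$ return whether $p\in s$; for $\neg\phi_1$ return the negation of $\mathsf{check}(\mathcal{F},L,s,\phi_1)$; for $\phi_1\land\phi_2$ return $\mathsf{check}(\mathcal{F},L,s,\phi_1)$ AND $\mathsf{check}(\mathcal{F},L,s,\phi_2)$; for $K_i\phi_1$: iterate over all $t\subseteq V$; if $t\vDash\theta$ and $t\cap O_i=s\cap O_i$, set stillExists := true, and for each $j=0,\ldots,k$, if $\mathsf{check}(\mathcal{F},[\ell_0,\ldots,\ell_{j-1}],t,\ell_j)$ is false set stillExists := false; if stillExists and $\mathsf{check}(\mathcal{F},[\ell_0,\ldots,\ell_k],t,\phi_1)$ is false, return false; after the iteration return true; for $[!\psi]\phi_1$: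 if $\mathsf{check}(\mathcal{F},L,s,\psi)$ is true, return $\mathsf{check}(\mathcal{F},[\ell_0,\ldots,\ell_k,\psi],s,\phi_1)$, else return true. -}

module Defs where

open import Data.Nat using (ℕ; zero; suc; _+_)
open import Data.Bool using (Bool; true; false; _∧_; not; if_then_else_; T)
open import Data.Fin using (Fin)
open import Data.Fin.Subset using (Subset; _∩_)
open import Data.Vec using (Vec; []; _∷_; lookup)
open import Data.Vec.Properties using (≡-dec)
import Data.Bool as B
open import Data.List using (List; []; _∷_; _++_; [_]; allFin; filter; take; length; zip; upTo)
open import Data.Product using (_×_; _,_)
open import Data.Unit using (⊤)
open import Data.Empty using (⊥)
open import Relation.Nullary using (¬_)
open import Relation.Nullary.Decidable using (⌊_⌋)
open import Relation.Binary.PropositionalEquality using (_≡_)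

-- Vocabulary V = Fin n (atoms), agents A = Fin m.
-- States are subsets s ⊆ V, represented as Subset n = Vec Bool n.

data BForm (n : ℕ) : Set where
  ⊤ᵇ ⊥ᵇ : BForm n
  atᵇ   : Fin n → BForm n
  ¬ᵇ_   : BForm n → BForm n
  _∧ᵇ_  : BForm n → BForm n → BForm n

evalᵇ : ∀ {n} → Subset n → BForm n → Bool
evalᵇ s ⊤ᵇ        = true
evalᵇ s ⊥ᵇ        = false
evalᵇ s (atᵇ p)   = lookup s p
evalᵇ s (¬ᵇ β)    = not (evalᵇ s β)
evalᵇ s (β ∧ᵇ γ)  = evalᵇ s β ∧ evalᵇ s γ

_⇒ᵇ_ : ∀ {n} → BForm n → BForm n → BForm n
β ⇒ᵇ γ = ¬ᵇ (β ∧ᵇ (¬ᵇ γ))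

subst : ∀ {n} → Fin n → BForm n → BForm n → BForm n
subst p χ ⊤ᵇ       = ⊤ᵇ
subst p χ ⊥ᵇ       = ⊥ᵇ
subst p χ (atᵇ q)  = if ⌊ p Data.Fin.≟ q ⌋ then χ else atᵇ q
subst p χ (¬ᵇ β)   = ¬ᵇ subst p χ β
subst p χ (β ∧ᵇ γ) = subst p χ β ∧ᵇ subst p χ γ

∀ᵇ : ∀ {n} → Fin n → BForm n → BForm n
∀ᵇ p β = subst p ⊤ᵇ β ∧ᵇ subst p ⊥ᵇ β

∀ᵇs : ∀ {n} → List (Fin n) → BForm n → BForm n
∀ᵇs []       β = β
∀ᵇs (p ∷ ps) β = ∀ᵇ p (∀ᵇs ps β)

complementAtoms : ∀ {n} → Subset n → List (Fin n)
complementAtoms {n} O = filter (λ p → B.T? (not (lookup O p))) (allFin n)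

data Form (n m : ℕ) : Set where
  ⊤ᶠ ⊥ᶠ : Form n m
  atᶠ   : Fin n → Form n m
  ¬ᶠ_   : Form n m → Form n m
  _∧ᶠ_  : Form n m → Form n m → Form n m
  K     : Fin m → Form n m → Form n m
  [!_]_ : Form n m → Form n m → Form n m

record KS (n m : ℕ) : Set where
  constructor ks
  field
    θ : BForm n
    O : Fin m → Subset n
open KS public

mutual
  ‖_‖ : ∀ {n m} → Form n m → KS n m → BForm n
  ‖ ⊤ᶠ ‖ F       = ⊤ᵇ
  ‖ ⊥ᶠ ‖ F       = ⊥ᵇ
  ‖ atᶠ p ‖ F    = atᵇ p
  ‖ ¬ᶠ ψ ‖ F     = ¬ᵇ ‖ ψ ‖ F
  ‖ ψ ∧ᶠ χ ‖ F   = ‖ ψ ‖ F ∧ᵇ ‖ χ ‖ F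
  ‖ K i ψ ‖ F    = ∀ᵇs (complementAtoms (O F i)) (θ F ⇒ᵇ ‖ ψ ‖ F)
  ‖ [! ψ ] ξ ‖ F = ‖ ψ ‖ F ⇒ᵇ ‖ ξ ‖ (announce F ψ)

  announce : ∀ {n m} → KS n m → Form n m → KS n m
  announce F ψ = ks (θ F ∧ᵇ ‖ ψ ‖ F) (O F)

announceAll : ∀ {n m} → KS n m → List (Form n m) → KS n m
announceAll F []      = F
announceAll F (ℓ ∷ L) = announceAll (announce F ℓ) L

IsState : ∀ {n m} → KS n m → Subset n → Set
IsState F s = T (evalᵇ s (θ F))

_,_⊨_ : ∀ {n m} → KS n m → Subset n → Form n m → Set
F , s ⊨ ⊤ᶠ        = ⊤
F , s ⊨ ⊥ᶠ        = ⊥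
F , s ⊨ atᶠ p     = T (lookup s p)
F , s ⊨ (¬ᶠ φ)    = ¬ (F , s ⊨ φ)
F , s ⊨ (φ ∧ᶠ ψ)  = (F , s ⊨ φ) × (F , s ⊨ ψ)
F , s ⊨ K i φ     = ∀ (t : Subset _) → IsState F t → t ∩ O F i ≡ s ∩ O F i → F , t ⊨ φ
F , s ⊨ ([! ψ ] φ) = F , s ⊨ ψ → announce F ψ , s ⊨ φ

allB : ∀ {A : Set} → (A → Bool) → List A → Bool
allB f []       = true
allB f (x ∷ xs) = f x ∧ allB f xs

allSubsets : (n : ℕ) → List (Subset n)
allSubsets zero    = [] ∷ []
allSubsets (suc n) = Data.List.map (true ∷_) (allSubsets n) ++ Data.List.map (false ∷_) (allSubsets n)

subsetEq : ∀ {n} → Subset n → Subset n → Bool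
subsetEq s t = ⌊ ≡-dec B._≟_ s t ⌋

size : ∀ {n m} → Form n m → ℕ
size ⊤ᶠ         = 1
size ⊥ᶠ         = 1
size (atᶠ p)    = 1
size (¬ᶠ φ)     = suc (size φ)
size (φ ∧ᶠ ψ)   = suc (size φ + size ψ)
size (K i φ)    = suc (size φ)
size ([! ψ ] φ) = suc (size ψ + size φ)

sizeL : ∀ {n m} → List (Form n m) → ℕ
sizeL []      = 0
sizeL (ℓ ∷ L) = size ℓ + sizeL L

-- The recursion of check is well-founded on sizeL L + size φ (which
-- strictly decreases on every recursive call) but not structural, so it
-- is implemented with a fuel argument; check supplies fuel strictly
-- larger than the measure, which is never exhausted.
checkFuel : ∀ {n m} → ℕ → KS n m → List (Form n m) → Subset n → Form n m → Bool
checkFuel zero    F L s φ            = false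
checkFuel (suc k) F L s ⊤ᶠ           = true
checkFuel (suc k) F L s ⊥ᶠ           = false
checkFuel (suc k) F L s (atᶠ p)      = lookup s p
checkFuel (suc k) F L s (¬ᶠ φ)       = not (checkFuel k F L s φ)
checkFuel (suc k) F L s (φ ∧ᶠ ψ)     = checkFuel k F L s φ ∧ checkFuel k F L s ψ
checkFuel {n} (suc k) F L s (K i φ)  =
  allB (λ t → not ( evalᵇ t (θ F)
                 ∧ subsetEq (t ∩ O F i) (s ∩ O F i)
                 ∧ stillExists t
                 ∧ not (checkFuel k F L t φ)))
      (allSubsets n)
  where
  stillExists : Subset n → Bool
  stillExists t = allB (λ jℓ → checkFuel k F (take (Data.Product.proj₁ jℓ) L) t (Data.Product.proj₂ jℓ))
                      (zip (upTo (length L)) L)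
checkFuel (suc k) F L s ([! ψ ] φ)   =
  if checkFuel k F L s ψ then checkFuel k F (L ++ [ ψ ]) s φ else true

check : ∀ {n m} → KS n m → List (Form n m) → Subset n → Form n m → Bool
check F L s φ = checkFuel (suc (sizeL L + size φ)) F L s φ

-- The Boolean translation is faithful on states: for a state t of G,
-- t ⊨ ‖ψ‖_G iff G, t ⊨ ψ, because quantifying ∀(V ∖ O_i) over θ → ‖ψ‖
-- ranges exactly over the states that agree with t on O_i.  Consequently
-- the states of F^{ℓ₀…ℓₖ} are the states t of F such that every ℓⱼ holds
-- at t in F^{ℓ₀…ℓⱼ₋₁}, which is what the stillExists test of check
-- computes.
module Submission where

open import Defs
open import Data.Bool using (Bool; true; false; _∧_; not; if_then_else_; T)
open import Data.Bool.Properties using (T-∧; T-≡; ∧-identityʳ; ∧-zeroʳ)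
open import Data.Fin using (Fin; _≟_)
open import Data.Fin.Subset using (Subset; _∩_)
open import Data.List using (List; []; _∷_; _++_; [_]; allFin; take; length; zip; upTo; applyUpTo)
import Data.List as List
open import Data.List.Membership.Propositional using (_∈_; _∉_)
open import Data.List.Membership.Propositional.Properties
  using (∈-filter⁺; ∈-filter⁻; ∈-allFin; ∈-map⁺; ∈-++⁺ˡ; ∈-++⁺ʳ)
open import Data.List.Relation.Unary.Any using (here; there)
open import Data.Nat using (ℕ; zero; suc; _+_; _≤_; _<_; s≤s; s≤s⁻¹)
open import Data.Nat.Properties
  using (+-assoc; +-identityʳ; +-monoʳ-<; <-≤-trans; ≤-<-trans; ≤-refl; m≤m+n; m≤n+m)
open import Data.Product using (_×_; _,_; proj₁; proj₂; map₁)
open import Data.Product.Function.NonDependent.Propositional using (_×-⇔_)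
open import Data.Unit using (⊤; tt)
open import Data.Vec using (Vec; []; _∷_; lookup; _[_]≔_)
open import Data.Vec.Properties
  using (lookup∘update; lookup∘update′; lookup-zipWith; tabulate∘lookup; tabulate-cong)
open import Function using (_∘_; id; _⇔_; mk⇔; Equivalence)
open import Function.Properties.Equivalence using () renaming (refl to ⇔-refl; sym to ⇔-sym; trans to ⇔-trans)
open import Function.Related.TypeIsomorphisms using (→-cong-⇔; ¬-cong-⇔)
open import Relation.Nullary using (¬_; Dec; yes; no)
open import Relation.Nullary.Decidable using (T?; toWitness; fromWitness)
open import Relation.Binary.PropositionalEquality as ≡ using (_≡_; refl; sym; trans; cong; cong₂; module ≡-Reasoning)

open Equivalence using (to; from)

T-not : ∀ {b} → T (not b) ⇔ (¬ T b)
T-not {true}  = mk⇔ (λ ()) (λ ¬t → ¬t tt)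
T-not {false} = mk⇔ (λ _ ()) (λ _ → tt)

¬T-not : ∀ b → (¬ T (not b)) ⇔ T b
¬T-not true  = mk⇔ (λ _ → tt) (λ _ ())
¬T-not false = mk⇔ (λ ¬t → ¬t tt) (λ ())

T-⇒ : ∀ {a b} → T (not (a ∧ not b)) ⇔ (T a → T b)
T-⇒ {false}        = mk⇔ (λ _ ()) (λ _ → tt)
T-⇒ {true} {true}  = mk⇔ (λ _ _ → tt) (λ _ → tt)
T-⇒ {true} {false} = mk⇔ (λ ()) (λ h → h tt)

T-⇒³ : ∀ {a b c d} → T (not (a ∧ b ∧ c ∧ not d)) ⇔ (T a → T b → T c → T d)
T-⇒³ {false}                      = mk⇔ (λ _ ()) (λ _ → tt)
T-⇒³ {true} {false}               = mk⇔ (λ _ _ ()) (λ _ → tt)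
T-⇒³ {true} {true} {false}        = mk⇔ (λ _ _ _ ()) (λ _ → tt)
T-⇒³ {true} {true} {true} {true}  = mk⇔ (λ _ _ _ _ → tt) (λ _ → tt)
T-⇒³ {true} {true} {true} {false} = mk⇔ (λ ()) (λ h → h tt tt tt)

T-if : ∀ {b c} → T (if b then c else true) ⇔ (T b → T c)
T-if {true}  = mk⇔ (λ c _ → c) (λ h → h tt)
T-if {false} = mk⇔ (λ _ ()) (λ _ → tt)

T-allB : ∀ {A : Set} (f : A → Bool) xs → T (allB f xs) ⇔ (∀ {x} → x ∈ xs → T (f x))
T-allB f []       = mk⇔ (λ _ ()) (λ _ → tt)
T-allB f (x ∷ xs) = mk⇔
  (λ h → λ { (here refl) → proj₁ (to T-∧ h) ; (there x∈xs) → to (T-allB f xs) (proj₂ (to T-∧ h)) x∈xs })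
  (λ h → from T-∧ (h (here refl) , from (T-allB f xs) (λ x∈xs → h (there x∈xs))))

T-subsetEq : ∀ {n} (u v : Subset n) → T (subsetEq u v) ⇔ (u ≡ v)
T-subsetEq u v = mk⇔ toWitness fromWitness

∈-allSubsets : ∀ {n} (t : Subset n) → t ∈ allSubsets n
∈-allSubsets []          = here refl
∈-allSubsets (true ∷ t)  = ∈-++⁺ˡ (∈-map⁺ (true ∷_) (∈-allSubsets t))
∈-allSubsets {suc n} (false ∷ t) =
  ∈-++⁺ʳ (List.map (true ∷_) (allSubsets n)) (∈-map⁺ (false ∷_) (∈-allSubsets t))

T-allB-allSubsets : ∀ {n} (f : Subset n → Bool) → T (allB f (allSubsets n)) ⇔ (∀ t → T (f t))
T-allB-allSubsets f = ⇔-trans (T-allB f _) (mk⇔ (λ h t → h (∈-allSubsets t)) (λ h {t} _ → h t))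

∈-complementAtoms : ∀ {n} (O : Subset n) {q} → q ∈ complementAtoms O ⇔ T (not (lookup O q))
∈-complementAtoms {n} O {q} = mk⇔ (proj₂ ∘ ∈-filter⁻ P? {xs = allFin n}) (∈-filter⁺ P? (∈-allFin q))
  where
  P? : ∀ p → Dec (T (not (lookup O p)))
  P? p = T? (not (lookup O p))

∉-complementAtoms : ∀ {n} (O : Subset n) q → q ∉ complementAtoms O ⇔ T (lookup O q)
∉-complementAtoms O q = ⇔-trans (¬-cong-⇔ (∈-complementAtoms O)) (¬T-not (lookup O q))

AllPrefixes : {A : Set} → (List A → A → Set) → List A → Set
AllPrefixes R []       = ⊤
AllPrefixes R (x ∷ xs) = R [] x × AllPrefixes (λ ys → R (x ∷ ys)) xs

AllPrefixes-cong : ∀ {A : Set} {R S : List A → A → Set} xs →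
                   (∀ ys x zs → ys ++ x ∷ zs ≡ xs → R ys x ⇔ S ys x) →
                   AllPrefixes R xs ⇔ AllPrefixes S xs
AllPrefixes-cong []       R⇔S = mk⇔ (λ _ → tt) (λ _ → tt)
AllPrefixes-cong (x ∷ xs) R⇔S =
  R⇔S [] x xs refl ×-⇔ AllPrefixes-cong xs (λ ys y zs eq → R⇔S (x ∷ ys) y zs (cong (x ∷_) eq))

allB-zip-applyUpTo : ∀ {A : Set} (h : ℕ × A → Bool) (f : ℕ → ℕ) xs →
                     allB h (zip (applyUpTo f (length xs)) xs) ≡ allB (h ∘ map₁ f) (zip (upTo (length xs)) xs)
allB-zip-applyUpTo h f []       = refl
allB-zip-applyUpTo h f (x ∷ xs) = cong (h (f 0 , x) ∧_)
  (trans (allB-zip-applyUpTo h (f ∘ suc) xs) (sym (allB-zip-applyUpTo (h ∘ map₁ f) suc xs)))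

T-allB-prefixes : ∀ {A : Set} (g : List A → A → Bool) xs →
                  T (allB (λ jx → g (take (proj₁ jx) xs) (proj₂ jx)) (zip (upTo (length xs)) xs))
                  ⇔ AllPrefixes (λ ys x → T (g ys x)) xs
T-allB-prefixes g []       = mk⇔ (λ _ → tt) (λ _ → tt)
T-allB-prefixes g (x ∷ xs)
  rewrite allB-zip-applyUpTo (λ jx → g (take (proj₁ jx) (x ∷ xs)) (proj₂ jx)) suc xs
  = ⇔-trans T-∧ (⇔-refl ×-⇔ T-allB-prefixes (λ ys → g (x ∷ ys)) xs)

evalᵇ-subst : ∀ {n} (t : Subset n) p χ β → evalᵇ t (subst p χ β) ≡ evalᵇ (t [ p ]≔ evalᵇ t χ) β
evalᵇ-subst t p χ ⊤ᵇ       = refl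
evalᵇ-subst t p χ ⊥ᵇ       = refl
evalᵇ-subst t p χ (atᵇ q) with p ≟ q
... | yes refl = sym (lookup∘update p t _)
... | no p≢q   = sym (lookup∘update′ (p≢q ∘ sym) t _)
evalᵇ-subst t p χ (¬ᵇ β)   = cong not (evalᵇ-subst t p χ β)
evalᵇ-subst t p χ (β ∧ᵇ γ) = cong₂ _∧_ (evalᵇ-subst t p χ β) (evalᵇ-subst t p χ γ)

T-∀ᵇ : ∀ {n} (t : Subset n) p β → T (evalᵇ t (∀ᵇ p β)) ⇔ (∀ b → T (evalᵇ (t [ p ]≔ b) β))
T-∀ᵇ t p β rewrite evalᵇ-subst t p ⊤ᵇ β | evalᵇ-subst t p ⊥ᵇ β = mk⇔
  (λ h → λ { true → proj₁ (to T-∧ h) ; false → proj₂ (to T-∧ h) })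
  (λ h → from T-∧ (h true , h false))

AgreeOutside : ∀ {n} → List (Fin n) → Subset n → Subset n → Set
AgreeOutside ps u t = ∀ q → q ∉ ps → lookup u q ≡ lookup t q

lookup-ext : ∀ {A : Set} {n} {u t : Vec A n} → (∀ q → lookup u q ≡ lookup t q) → u ≡ t
lookup-ext {u = u} {t} u≗t = trans (sym (tabulate∘lookup u)) (trans (tabulate-cong u≗t) (tabulate∘lookup t))

T-∀ᵇs : ∀ {n} ps β (t : Subset n) →
        T (evalᵇ t (∀ᵇs ps β)) ⇔ (∀ u → AgreeOutside ps u t → T (evalᵇ u β))
T-∀ᵇs []       β t = mk⇔
  (λ h u u≈t → ≡.subst (λ w → T (evalᵇ w β)) (sym (lookup-ext (λ q → u≈t q λ ()))) h)
  (λ h → h t (λ _ _ → refl))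
T-∀ᵇs (p ∷ ps) β t = ⇔-trans (T-∀ᵇ t p (∀ᵇs ps β)) (mk⇔ fwd bwd)
  where
  fwd : (∀ b → T (evalᵇ (t [ p ]≔ b) (∀ᵇs ps β))) → ∀ u → AgreeOutside (p ∷ ps) u t → T (evalᵇ u β)
  fwd h u u≈t = to (T-∀ᵇs ps β _) (h (lookup u p)) u u≈t[p≔u]
    where
    u≈t[p≔u] : AgreeOutside ps u (t [ p ]≔ lookup u p)
    u≈t[p≔u] q q∉ps with q ≟ p
    ... | yes refl = sym (lookup∘update q t _)
    ... | no q≢p   = trans (u≈t q λ { (here q≡p) → q≢p q≡p ; (there q∈ps) → q∉ps q∈ps })
                           (sym (lookup∘update′ q≢p t _))
  bwd : (∀ u → AgreeOutside (p ∷ ps) u t → T (evalᵇ u β)) → ∀ b → T (evalᵇ (t [ p ]≔ b) (∀ᵇs ps β))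
  bwd h b = from (T-∀ᵇs ps β _) λ u u≈t[p≔b] →
    h u λ q q∉ → trans (u≈t[p≔b] q (q∉ ∘ there)) (lookup∘update′ (q∉ ∘ here) t b)

∩-≡⇔agreeOn : ∀ {n} (O u t : Subset n) →
              (u ∩ O ≡ t ∩ O) ⇔ (∀ q → T (lookup O q) → lookup u q ≡ lookup t q)
∩-≡⇔agreeOn O u t = mk⇔ fwd bwd
  where
  open ≡-Reasoning
  fwd : u ∩ O ≡ t ∩ O → ∀ q → T (lookup O q) → lookup u q ≡ lookup t q
  fwd eq q Oq = begin
    lookup u q                ≡⟨ sym (∧-identityʳ _) ⟩
    lookup u q ∧ true         ≡⟨ cong (lookup u q ∧_) (sym (to T-≡ Oq)) ⟩
    lookup u q ∧ lookup O q   ≡⟨ sym (lookup-zipWith _∧_ q u O) ⟩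
    lookup (u ∩ O) q          ≡⟨ cong (λ w → lookup w q) eq ⟩
    lookup (t ∩ O) q          ≡⟨ lookup-zipWith _∧_ q t O ⟩
    lookup t q ∧ lookup O q   ≡⟨ cong (lookup t q ∧_) (to T-≡ Oq) ⟩
    lookup t q ∧ true         ≡⟨ ∧-identityʳ _ ⟩
    lookup t q                ∎
  bwd : (∀ q → T (lookup O q) → lookup u q ≡ lookup t q) → u ∩ O ≡ t ∩ O
  bwd agree = lookup-ext λ q → begin
    lookup (u ∩ O) q          ≡⟨ lookup-zipWith _∧_ q u O ⟩
    lookup u q ∧ lookup O q   ≡⟨ masked q ⟩
    lookup t q ∧ lookup O q   ≡⟨ sym (lookup-zipWith _∧_ q t O) ⟩
    lookup (t ∩ O) q          ∎
    where
    masked : ∀ q → lookup u q ∧ lookup O q ≡ lookup t q ∧ lookup O q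
    masked q with lookup O q in Oq
    ... | true  = cong (_∧ true) (agree q (from T-≡ Oq))
    ... | false = trans (∧-zeroʳ _) (sym (∧-zeroʳ _))

agreeOutside-complementAtoms : ∀ {n} (O u t : Subset n) →
                               AgreeOutside (complementAtoms O) u t ⇔ (u ∩ O ≡ t ∩ O)
agreeOutside-complementAtoms O u t = ⇔-trans
  (mk⇔ (λ agree q Oq → agree q (from (∉-complementAtoms O q) Oq))
       (λ agree q q∉ → agree q (to (∉-complementAtoms O q) q∉)))
  (⇔-sym (∩-≡⇔agreeOn O u t))

T-‖‖ : ∀ {n m} (G : KS n m) ψ {t} → IsState G t → T (evalᵇ t (‖ ψ ‖ G)) ⇔ (G , t ⊨ ψ)
T-‖‖ G ⊤ᶠ       t∈G = mk⇔ (λ _ → tt) (λ _ → tt)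
T-‖‖ G ⊥ᶠ       t∈G = mk⇔ (λ ()) (λ ())
T-‖‖ G (atᶠ p)  t∈G = ⇔-refl
T-‖‖ G (¬ᶠ ψ)   t∈G = ⇔-trans T-not (¬-cong-⇔ (T-‖‖ G ψ t∈G))
T-‖‖ G (ψ ∧ᶠ χ) t∈G = ⇔-trans T-∧ (T-‖‖ G ψ t∈G ×-⇔ T-‖‖ G χ t∈G)
T-‖‖ G (K i ψ) {t} t∈G = ⇔-trans (T-∀ᵇs (complementAtoms (O G i)) (θ G ⇒ᵇ ‖ ψ ‖ G) t) (mk⇔ fwd bwd)
  where
  u≈t⇔ : ∀ u → AgreeOutside (complementAtoms (O G i)) u t ⇔ (u ∩ O G i ≡ t ∩ O G i)
  u≈t⇔ u = agreeOutside-complementAtoms (O G i) u t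
  fwd : (∀ u → AgreeOutside _ u t → T (evalᵇ u (θ G ⇒ᵇ ‖ ψ ‖ G))) → G , t ⊨ K i ψ
  fwd h u u∈G u∩O = to (T-‖‖ G ψ u∈G) (to T-⇒ (h u (from (u≈t⇔ u) u∩O)) u∈G)
  bwd : G , t ⊨ K i ψ → ∀ u → AgreeOutside _ u t → T (evalᵇ u (θ G ⇒ᵇ ‖ ψ ‖ G))
  bwd h u u≈t = from T-⇒ λ u∈G → from (T-‖‖ G ψ u∈G) (h u u∈G (to (u≈t⇔ u) u≈t))
T-‖‖ G ([! ψ ] ξ) {t} t∈G = ⇔-trans T-⇒ (mk⇔ fwd bwd)
  where
  ψ-true : Set
  ψ-true = T (evalᵇ t (‖ ψ ‖ G))
  ξ-true : Set
  ξ-true = T (evalᵇ t (‖ ξ ‖ (announce G ψ)))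
  t∈Gψ : ψ-true → IsState (announce G ψ) t
  t∈Gψ ψt = from T-∧ (t∈G , ψt)
  fwd : (ψ-true → ξ-true) → G , t ⊨ ([! ψ ] ξ)
  fwd h t⊨ψ = let ψt = from (T-‖‖ G ψ t∈G) t⊨ψ in to (T-‖‖ (announce G ψ) ξ (t∈Gψ ψt)) (h ψt)
  bwd : G , t ⊨ ([! ψ ] ξ) → ψ-true → ξ-true
  bwd h ψt = from (T-‖‖ (announce G ψ) ξ (t∈Gψ ψt)) (h (to (T-‖‖ G ψ t∈G) ψt))

O-announceAll : ∀ {n m} (F : KS n m) L → O (announceAll F L) ≡ O F
O-announceAll F []      = refl
O-announceAll F (ℓ ∷ L) = O-announceAll (announce F ℓ) L

announceAll-++ : ∀ {n m} (F : KS n m) L M → announceAll F (L ++ M) ≡ announceAll (announceAll F L) M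
announceAll-++ F []      M = refl
announceAll-++ F (ℓ ∷ L) M = announceAll-++ (announce F ℓ) L M

IsState-announceAll⁻ : ∀ {n m} (F : KS n m) L {t} → IsState (announceAll F L) t → IsState F t
IsState-announceAll⁻ F []      t∈F = t∈F
IsState-announceAll⁻ F (ℓ ∷ L) t∈FL = proj₁ (to T-∧ (IsState-announceAll⁻ (announce F ℓ) L t∈FL))

IsState-announceAll : ∀ {n m} (F : KS n m) L {t} → IsState F t →
                      IsState (announceAll F L) t ⇔ AllPrefixes (λ P ℓ → announceAll F P , t ⊨ ℓ) L
IsState-announceAll F []      t∈F = mk⇔ (λ _ → tt) (λ _ → t∈F)
IsState-announceAll F (ℓ ∷ L) {t} t∈F = mk⇔ fwd bwd
  where
  fwd : IsState (announceAll F (ℓ ∷ L)) t → AllPrefixes (λ P ℓ′ → announceAll F P , t ⊨ ℓ′) (ℓ ∷ L)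
  fwd t∈FL = let t∈Fℓ = IsState-announceAll⁻ (announce F ℓ) L t∈FL in
    to (T-‖‖ F ℓ t∈F) (proj₂ (to T-∧ t∈Fℓ)) , to (IsState-announceAll (announce F ℓ) L t∈Fℓ) t∈FL
  bwd : AllPrefixes (λ P ℓ′ → announceAll F P , t ⊨ ℓ′) (ℓ ∷ L) → IsState (announceAll F (ℓ ∷ L)) t
  bwd (t⊨ℓ , rest) =
    from (IsState-announceAll (announce F ℓ) L (from T-∧ (t∈F , from (T-‖‖ F ℓ t∈F) t⊨ℓ))) rest

sizeL-++ : ∀ {n m} (L M : List (Form n m)) → sizeL (L ++ M) ≡ sizeL L + sizeL M
sizeL-++ []      M = refl
sizeL-++ (ℓ ∷ L) M = trans (cong (size ℓ +_) (sizeL-++ L M)) (sym (+-assoc (size ℓ) (sizeL L) (sizeL M)))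

sizeL-prefix : ∀ {n m} {P : List (Form n m)} {ℓ M L} → P ++ ℓ ∷ M ≡ L → sizeL P + size ℓ ≤ sizeL L
sizeL-prefix {P = P} {ℓ} {M} refl = ≡.subst (sizeL P + size ℓ ≤_)
  (trans (+-assoc (sizeL P) (size ℓ) (sizeL M)) (sym (sizeL-++ P (ℓ ∷ M))))
  (m≤m+n (sizeL P + size ℓ) (sizeL M))

fuel-shrinks : ∀ {l a b k} → a < b → l + b < suc k → l + a < k
fuel-shrinks {l} a<b l+b<1+k = <-≤-trans (+-monoʳ-< l a<b) (s≤s⁻¹ l+b<1+k)

CheckCorrect : ∀ {n m} → KS n m → ℕ → Set
CheckCorrect F k = ∀ L s φ → sizeL L + size φ < k →
                   T (checkFuel k F L s φ) ⇔ (announceAll F L , s ⊨ φ)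

checkFuel-announce : ∀ {n m} (F : KS n m) {k} → CheckCorrect F k → ∀ {L s} ψ φ →
                     sizeL L + size ([! ψ ] φ) < suc k →
                     T (checkFuel (suc k) F L s ([! ψ ] φ)) ⇔ (announceAll F L , s ⊨ ([! ψ ] φ))
checkFuel-announce F {k} correct {L} {s} ψ φ lt =
  ⇔-trans T-if (→-cong-⇔ (correct L s ψ (fuel-shrinks (s≤s (m≤m+n _ _)) lt)) correctφ)
  where
  open ≡-Reasoning
  measure : sizeL (L ++ [ ψ ]) + size φ ≡ sizeL L + (size ψ + size φ)
  measure = begin
    sizeL (L ++ [ ψ ]) + size φ       ≡⟨ cong (_+ size φ) (sizeL-++ L [ ψ ]) ⟩
    sizeL L + (size ψ + 0) + size φ   ≡⟨ cong (λ x → sizeL L + x + size φ) (+-identityʳ (size ψ)) ⟩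
    sizeL L + size ψ + size φ         ≡⟨ +-assoc (sizeL L) (size ψ) (size φ) ⟩
    sizeL L + (size ψ + size φ)       ∎
  correctφ : T (checkFuel k F (L ++ [ ψ ]) s φ) ⇔ (announce (announceAll F L) ψ , s ⊨ φ)
  correctφ = ≡.subst (λ H → T (checkFuel k F (L ++ [ ψ ]) s φ) ⇔ (H , s ⊨ φ)) (announceAll-++ F L [ ψ ])
    (correct (L ++ [ ψ ]) s φ (≡.subst (_< k) (sym measure) (fuel-shrinks ≤-refl lt)))

checkFuel-K : ∀ {n m} (F : KS n m) {k} → CheckCorrect F k → ∀ {L s} i φ →
              sizeL L + size (K i φ) < suc k →
              T (checkFuel (suc k) F L s (K i φ)) ⇔ (announceAll F L , s ⊨ K i φ)
checkFuel-K F {k} correct {L} {s} i φ lt = ⇔-trans (T-allB-allSubsets _) (mk⇔ fwd bwd)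
  where
  G : KS _ _
  G = announceAll F L
  stillExists : Subset _ → Bool
  stillExists t = allB (λ jℓ → checkFuel k F (take (proj₁ jℓ) L) t (proj₂ jℓ)) (zip (upTo (length L)) L)
  L+φ<k : sizeL L + size φ < k
  L+φ<k = fuel-shrinks ≤-refl lt
  stillExists⇔ : ∀ {t} → IsState F t → T (stillExists t) ⇔ IsState G t
  stillExists⇔ {t} t∈F = ⇔-trans (T-allB-prefixes (λ P ℓ → checkFuel k F P t ℓ) L) (⇔-trans
    (AllPrefixes-cong L λ P ℓ _ eq → correct P t ℓ (≤-<-trans (sizeL-prefix eq) (≤-<-trans (m≤m+n _ _) L+φ<k)))
    (⇔-sym (IsState-announceAll F L t∈F)))
  refutes : Subset _ → Bool
  refutes t = evalᵇ t (θ F) ∧ subsetEq (t ∩ O F i) (s ∩ O F i) ∧ stillExists t ∧ not (checkFuel k F L t φ)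
  indistinguishable-G≡F : ∀ {t} → (t ∩ O G i ≡ s ∩ O G i) ≡ (t ∩ O F i ≡ s ∩ O F i)
  indistinguishable-G≡F {t} = cong (λ O′ → t ∩ O′ i ≡ s ∩ O′ i) (O-announceAll F L)
  fwd : (∀ t → T (not (refutes t))) → G , s ⊨ K i φ
  fwd h t t∈G t∩O = to (correct L t φ L+φ<k) (to T-⇒³ (h t) t∈F
    (from (T-subsetEq _ _) (≡.subst id indistinguishable-G≡F t∩O)) (from (stillExists⇔ t∈F) t∈G))
    where
    t∈F : IsState F t
    t∈F = IsState-announceAll⁻ F L t∈G
  bwd : G , s ⊨ K i φ → ∀ t → T (not (refutes t))
  bwd h t = from T-⇒³ λ t∈F t∩O t∈G → from (correct L t φ L+φ<k)
    (h t (to (stillExists⇔ t∈F) t∈G) (≡.subst id (sym indistinguishable-G≡F) (to (T-subsetEq _ _) t∩O)))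

checkFuel-correct : ∀ {n m} (F : KS n m) k → CheckCorrect F k
checkFuel-correct F zero    L s φ          ()
checkFuel-correct F (suc k) L s ⊤ᶠ         _  = mk⇔ (λ _ → tt) (λ _ → tt)
checkFuel-correct F (suc k) L s ⊥ᶠ         _  = mk⇔ (λ ()) (λ ())
checkFuel-correct F (suc k) L s (atᶠ p)    _  = ⇔-refl
checkFuel-correct F (suc k) L s (¬ᶠ φ)     lt =
  ⇔-trans T-not (¬-cong-⇔ (checkFuel-correct F k L s φ (fuel-shrinks ≤-refl lt)))
checkFuel-correct F (suc k) L s (φ ∧ᶠ ψ)   lt = ⇔-trans T-∧
  (checkFuel-correct F k L s φ (fuel-shrinks (s≤s (m≤m+n _ _)) lt) ×-⇔
   checkFuel-correct F k L s ψ (fuel-shrinks (s≤s (m≤n+m _ _)) lt))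
checkFuel-correct F (suc k) L s (K i φ)    lt = checkFuel-K F (checkFuel-correct F k) i φ lt
checkFuel-correct F (suc k) L s ([! ψ ] φ) lt = checkFuel-announce F (checkFuel-correct F k) ψ φ lt

lemma3 : {n m : ℕ} (F : KS n m) (s : Subset n) → IsState F s →
    (L : List (Form n m)) (φ : Form n m) →
    ((announceAll F L , s ⊨ φ) → check F L s φ ≡ true) × (check F L s φ ≡ true → (announceAll F L , s ⊨ φ))
lemma3 F s _ L φ = to T-≡ ∘ from correct , to correct ∘ from T-≡
  where
  correct : T (check F L s φ) ⇔ (announceAll F L , s ⊨ φ)
  correct = checkFuel-correct F (suc (sizeL L + size φ)) L s φ ≤-refl
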